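{- Let $(\Sigma,\omega)$ be an oriented signed graph and $(W,\omega_W)$ a directed walk with $W=v_0e_1v_1\cdots e_nv_n$, $n>0$. Then $\partial f_{(W,\omega_W)}(v)=0$ for every vertex $v\neq v_0,v_n$. If $W$ is closed, then \[ \partial f_{(W,\omega_W)}(v_0)=\begin{cases}0 & \text{if } \sigma(W)=+1,\\ 2\,\omega_W(v_0,e_1) & \text{if } \sigma(W)=-1.\end{cases} \] If $W$ is open ($v_0\neq v_n$), then $\partial f_{(W,\omega_W)}(v_0)=\omega_W(v_0,e_1)$ and $\partial f_{(W,\omega_W)}(v_n)=\omega_W(v_n,e_n)=-\sigma(W)\,\omega_W(v_0,e_1)$.
   Context: Signed graph: finite graph (loops, multiple edges allowed) with edge signs $\sigma(e)\in\{\pm1\}$; each edge has two ends $(u,e),(v,e)$ (a loop has two distinct ends). An orientation assigns $\omega(v,e)\in\{\pm1\}$ to edge ends with $\sigma(e)=-\omega(u,e)\omega(v,e)$. Coupling $[\omega_1,\omega_2](e)=\omega_1(v,e)\omega_2(v,e)$ for either end. A walk $W=v_0e_1\cdots e_nv_n$ has sign $\sigma(W)=\prod\sigma(e_i)$, closed if $n\ge1$ and $v_0=v_n$, open otherwise. A direction $\omega_W$ assigns an orientation to each occurrence $e_i$ such that $\omega_W(v_i,e_i)\omega_W(v_i,e_{i+1})=-1$ at each internal vertex $v_i$, $0<i<n$ (using the ends traversed by the walk; $\omega_W(v_0,e_1)$ and $\omega_W(v_n,e_n)$ refer to the initial end of $e_1$ and terminal end of $e_n$). $f_{(W,\omega_W)}(e)=\sum_{i:e_i=e}[\omega,\omega_W](e_i)$.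 Boundary $\partial g(v)=\sum_{(v,e)}\omega(v,e)g(e)$ over all edge ends at $v$. -}

module Defs where

open import Data.Nat using (ℕ; zero; suc)
open import Data.Fin using (Fin; zero; suc; toℕ; fromℕ; inject₁; _≟_)
open import Data.Bool using (Bool; true; false; not)
open import Data.Sign using (Sign) renaming (_*_ to _*ˢ_; opposite to negˢ)
open import Data.Integer using (ℤ; 0ℤ; _+_; _*_; _◃_)
open import Relation.Nullary using (yes; no)
open import Relation.Binary.PropositionalEquality using (_≡_)

⟦_⟧ : Sign → ℤ
⟦ s ⟧ = s ◃ 1

∑ : (n : ℕ) → (Fin n → ℤ) → ℤ
∑ zero    f = 0ℤ
∑ (suc n) f = f zero + ∑ n (λ i → f (suc i))

∏ : (n : ℕ) → (Fin n → Sign) → Sign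
∏ zero    f = Sign.+
∏ (suc n) f = f zero *ˢ ∏ n (λ i → f (suc i))

-- Each edge e has two distinct ends, labelled by Bool; end e b is the
-- vertex at which end b of e lies (a loop has both ends at one vertex).
record SignedGraph : Set where
  field
    nv  : ℕ
    ne  : ℕ
    end : Fin ne → Bool → Fin nv
    σ   : Fin ne → Sign
open SignedGraph public

Vertex : SignedGraph → Set
Vertex Σ = Fin (nv Σ)

Edge : SignedGraph → Set
Edge Σ = Fin (ne Σ)

IsEdgeOrientation : (Σ : SignedGraph) → Edge Σ → (Bool → Sign) → Set
IsEdgeOrientation Σ e o = σ Σ e ≡ negˢ (o true *ˢ o false)

record Orientation (Σ : SignedGraph) : Set where
  field
    ω    : Edge Σ → Bool → Sign
    isOr : ∀ e → IsEdgeOrientation Σ e (ω e)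
open Orientation public

-- Step i (i : Fin n) traverses
-- edge (edge i) from its end (start i) (lying at vertex (vtx (inject₁ i)))
-- to its other end (not (start i)) (lying at vertex (vtx (suc i))).
record Walk (Σ : SignedGraph) (n : ℕ) : Set where
  field
    vtx      : Fin (suc n) → Vertex Σ
    edge     : Fin n → Edge Σ
    start    : Fin n → Bool
    startOK  : ∀ i → end Σ (edge i) (start i) ≡ vtx (inject₁ i)
    finishOK : ∀ i → end Σ (edge i) (not (start i)) ≡ vtx (suc i)
open Walk public

walkSign : {Σ : SignedGraph} {n : ℕ} → Walk Σ n → Sign
walkSign {Σ} {n} W = ∏ n (λ i → σ Σ (edge W i))

record Direction {Σ : SignedGraph} {n : ℕ} (W : Walk Σ n) : Set where
  field
    ωW       : Fin n → Bool → Sign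
    isOr     : ∀ i → IsEdgeOrientation Σ (edge W i) (ωW i)
    internal : ∀ (i j : Fin n) → toℕ j ≡ suc (toℕ i) →
               (ωW i (not (start W i)) *ˢ ωW j (start W j)) ≡ Sign.-
open Direction public

-- Coupling [ω, ω_W](e_i) = ω(v,e_i) ω_W(v,e_i), evaluated at end true
-- (independent of the chosen end since both are orientations of e_i).
coupling : {Σ : SignedGraph} {n : ℕ} {W : Walk Σ n} →
           Orientation Σ → Direction W → Fin n → Sign
coupling {W = W} O D i = ω O (edge W i) true *ˢ ωW D i true

fW : {Σ : SignedGraph} {n : ℕ} {W : Walk Σ n} →
     Orientation Σ → Direction W → Edge Σ → ℤ
fW {n = n} {W = W} O D e =
  ∑ n (λ i → case-eq (edge W i ≟ e) i)
  where
  case-eq : ∀ {x} → Relation.Nullary.Dec x → Fin n → ℤ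
  case-eq (yes _) i = ⟦ coupling O D i ⟧
  case-eq (no  _) i = 0ℤ

∂ : {Σ : SignedGraph} → Orientation Σ → (Edge Σ → ℤ) → Vertex Σ → ℤ
∂ {Σ} O g v = ∑ (ne Σ) (λ e → atEnd e true + atEnd e false)
  where
  atEnd : Edge Σ → Bool → ℤ
  atEnd e b with end Σ e b ≟ v
  ... | yes _ = ⟦ ω O e b ⟧ * g e
  ... | no  _ = 0ℤ

-- Expanding ∂ through the incidence matrix η, ∂ f_W (v) = ∑ᵢ η(v, eᵢ) [ω, ω_W](eᵢ), and since ω(u, eᵢ) [ω, ω_W](eᵢ)
-- = ω_W(u, eᵢ) at either end u of eᵢ, step i contributes ω_W(vᵢ₋₁, eᵢ) at vᵢ₋₁ and ω_W(vᵢ, eᵢ) at vᵢ. At an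
-- internal vertex the terminal sign of one step cancels the initial sign of the next, so the sum telescopes to
-- ω_W(v₀, e₁) at v₀ plus ω_W(vₙ, eₙ) at vₙ. Along each step the direction is multiplied by the edge sign, so
-- ω_W(vₙ, eₙ) = -σ(W) ω_W(v₀, e₁), which gives the closed case.
module Submission where

open import Defs
open import Data.Nat using (ℕ; zero; suc)
open import Data.Fin using (Fin; zero; suc; fromℕ; inject₁; _≟_)
open import Data.Fin.Properties using (toℕ-inject₁)
open import Data.Bool using (Bool; true; false; not; if_then_else_)
open import Data.Sign using (Sign) renaming (_*_ to _*ˢ_; opposite to negˢ)
import Data.Sign.Properties as Signₚ
open import Data.Integer using (ℤ; 0ℤ; 1ℤ; -1ℤ; _+_; _*_; -_; +_)
open import Data.Integer.Properties
  using (+-*-semiring; *-identityˡ; +-comm; +-identityˡ; +-identityʳ; ◃-distrib-*)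
open import Data.Integer.Tactic.RingSolver using (solve-∀)
open import Algebra.Properties.Semiring.Sum +-*-semiring
  using (sum; sum-cong-≗; sum-replicate-zero; ∑-comm; *-distribˡ-sum)
open import Data.Product using (_×_; _,_)
open import Function using (_∘_)
open import Relation.Nullary using (¬_; Dec; does; yes; no)
open import Relation.Nullary.Decidable using (dec-true; dec-false)
open import Relation.Binary.PropositionalEquality
  using (_≡_; refl; sym; trans; cong; cong₂; module ≡-Reasoning)

δ : ∀ {p} {P : Set p} → Dec P → ℤ
δ d = if does d then 1ℤ else 0ℤ

δ-yes : ∀ {p} {P : Set p} (d : Dec P) → P → δ d ≡ 1ℤ
δ-yes d p = cong (if_then 1ℤ else 0ℤ) (dec-true d p)

δ-no : ∀ {p} {P : Set p} (d : Dec P) → ¬ P → δ d ≡ 0ℤ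
δ-no d ¬p = cong (if_then 1ℤ else 0ℤ) (dec-false d ¬p)

∑≡sum : ∀ n (f : Fin n → ℤ) → ∑ n f ≡ sum f
∑≡sum zero    f = refl
∑≡sum (suc n) f = cong (λ s → f zero + s) (∑≡sum n (f ∘ suc))

∑-select : ∀ {n} (x : Fin n) (h : Fin n → ℤ) → sum (λ e → δ (x ≟ e) * h e) ≡ h x
∑-select {suc n} zero    h = trans (cong₂ _+_ (*-identityˡ (h zero)) (sum-replicate-zero n))
                                  (+-identityʳ (h zero))
-- δ (suc x ≟ suc e) reduces to δ (x ≟ e), since Fin's _≟_ is map′ on the tails and map′ keeps does.
∑-select         (suc x) h = trans (+-identityˡ _) (∑-select x (h ∘ suc))

∑-*-pushforward : ∀ {k n} (h : Fin k → ℤ) (x : Fin n → Fin k) (c : Fin n → ℤ) →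
  sum (λ e → h e * sum (λ i → δ (x i ≟ e) * c i)) ≡ sum (λ i → h (x i) * c i)
∑-*-pushforward h x c = begin
  sum (λ e → h e * sum (λ i → δ (x i ≟ e) * c i))
    ≡⟨ sum-cong-≗ (λ e → *-distribˡ-sum (h e) (λ i → δ (x i ≟ e) * c i)) ⟩
  sum (λ e → sum (λ i → h e * (δ (x i ≟ e) * c i)))
    ≡⟨ sum-cong-≗ (λ e → sum-cong-≗ (λ i → swap (h e) (δ (x i ≟ e)) (c i))) ⟩
  sum (λ e → sum (λ i → δ (x i ≟ e) * (h e * c i)))
    ≡⟨ ∑-comm (λ e i → δ (x i ≟ e) * (h e * c i)) ⟩
  sum (λ i → sum (λ e → δ (x i ≟ e) * (h e * c i)))
    ≡⟨ sum-cong-≗ (λ i → ∑-select (x i) (λ e → h e * c i)) ⟩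
  sum (λ i → h (x i) * c i) ∎
  where
  open ≡-Reasoning
  swap : ∀ a b c → a * (b * c) ≡ b * (a * c)
  swap = solve-∀

η : {Σ : SignedGraph} → Orientation Σ → Vertex Σ → Edge Σ → ℤ
η {Σ} O v e = δ (end Σ e true ≟ v) * ⟦ ω O e true ⟧ + δ (end Σ e false ≟ v) * ⟦ ω O e false ⟧

-- ∂ and fW sum local functions of Defs, which cannot be named here; integrand reads them off the sum.
integrand : ∀ {n} {f : Fin n → ℤ} → ∑ n f ≡ ∑ n f → Fin n → ℤ
integrand {f = f} _ = f

∂-as-sum : {Σ : SignedGraph} (O : Orientation Σ) (g : Edge Σ → ℤ) (v : Vertex Σ) →
  ∂ O g v ≡ sum (λ e → η O v e * g e)
∂-as-sum {Σ} O g v =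
  trans (∑≡sum (ne Σ) _) (sum-cong-≗ λ e → trans (ends e) (sym (distrib (δ (end Σ e true ≟ v))
    (δ (end Σ e false ≟ v)) ⟦ ω O e true ⟧ ⟦ ω O e false ⟧ (g e))))
  where
  distrib : ∀ a b x y z → (a * x + b * y) * z ≡ a * (x * z) + b * (y * z)
  distrib = solve-∀
  ends : ∀ e → integrand (refl {x = ∂ O g v}) e
             ≡ δ (end Σ e true ≟ v) * (⟦ ω O e true ⟧ * g e)
               + δ (end Σ e false ≟ v) * (⟦ ω O e false ⟧ * g e)
  ends e with end Σ e true ≟ v | end Σ e false ≟ v
  ... | yes _ | yes _ = cong₂ _+_ (sym (*-identityˡ (⟦ ω O e true ⟧ * g e))) (sym (*-identityˡ _))
  ... | yes _ | no  _ = cong₂ _+_ (sym (*-identityˡ (⟦ ω O e true ⟧ * g e))) refl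
  ... | no  _ | yes _ = cong₂ _+_ (refl {x = 0ℤ}) (sym (*-identityˡ (⟦ ω O e false ⟧ * g e)))
  ... | no  _ | no  _ = refl

fW-as-sum : {Σ : SignedGraph} {n : ℕ} {W : Walk Σ n} (O : Orientation Σ) (D : Direction W)
  (e : Edge Σ) → fW O D e ≡ sum (λ i → δ (edge W i ≟ e) * ⟦ coupling O D i ⟧)
fW-as-sum {n = n} {W} O D e = trans (∑≡sum n _) (sum-cong-≗ occurrence)
  where
  occurrence : ∀ i → integrand (refl {x = fW O D e}) i ≡ δ (edge W i ≟ e) * ⟦ coupling O D i ⟧
  occurrence i with edge W i ≟ e
  ... | yes _ = sym (*-identityˡ _)
  ... | no  _ = refl

⟦⟧-* : ∀ s t → ⟦ s *ˢ t ⟧ ≡ ⟦ s ⟧ * ⟦ t ⟧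
⟦⟧-* s t = ◃-distrib-* s t 1 1

⟦⟧-negˢ : ∀ s → ⟦ negˢ s ⟧ ≡ - ⟦ s ⟧
⟦⟧-negˢ Sign.+ = refl
⟦⟧-negˢ Sign.- = refl

*ˢ-cancelˡ : ∀ x y → x *ˢ (x *ˢ y) ≡ y
*ˢ-cancelˡ Sign.+ y = refl
*ˢ-cancelˡ Sign.- y = Signₚ.opposite-involutive y

*ˢ≡-⇒≡negˢ : ∀ x y → x *ˢ y ≡ Sign.- → y ≡ negˢ x
*ˢ≡-⇒≡negˢ Sign.+ y       p = p
*ˢ≡-⇒≡negˢ Sign.- Sign.+ _ = refl

end-opposite : ∀ {s} (o : Bool → Sign) → s ≡ negˢ (o true *ˢ o false) →
  ∀ b → o (not b) ≡ negˢ (s *ˢ o b)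
end-opposite o s≡ true rewrite s≡ = other-end (o true) (o false)
  where
  other-end : ∀ x y → y ≡ negˢ (negˢ (x *ˢ y) *ˢ x)
  other-end Sign.+ Sign.+ = refl
  other-end Sign.+ Sign.- = refl
  other-end Sign.- Sign.+ = refl
  other-end Sign.- Sign.- = refl
end-opposite o s≡ false =
  end-opposite (o ∘ not) (trans s≡ (cong negˢ (Signₚ.*-comm (o true) (o false)))) true

coupling-transport : ∀ (o o' : Bool → Sign) → o true *ˢ o false ≡ o' true *ˢ o' false →
  ∀ b → o b *ˢ (o true *ˢ o' true) ≡ o' b
coupling-transport o o' same-product true  = *ˢ-cancelˡ (o true) (o' true)
coupling-transport o o' same-product false = begin
  o false *ˢ (o true *ˢ o' true)   ≡⟨ sym (Signₚ.*-assoc (o false) (o true) (o' true)) ⟩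
  (o false *ˢ o true) *ˢ o' true   ≡⟨ cong (_*ˢ o' true) (Signₚ.*-comm (o false) (o true)) ⟩
  (o true *ˢ o false) *ˢ o' true   ≡⟨ cong (_*ˢ o' true) same-product ⟩
  (o' true *ˢ o' false) *ˢ o' true ≡⟨ Signₚ.*-comm (o' true *ˢ o' false) (o' true) ⟩
  o' true *ˢ (o' true *ˢ o' false) ≡⟨ *ˢ-cancelˡ (o' true) (o' false) ⟩
  o' false                         ∎
  where open ≡-Reasoning

∏-propagate : ∀ m (s a : Fin (suc m) → Sign) →
  (∀ (i : Fin m) → a (suc i) ≡ s (inject₁ i) *ˢ a (inject₁ i)) →
  s (fromℕ m) *ˢ a (fromℕ m) ≡ ∏ (suc m) s *ˢ a zero
∏-propagate zero    s a _    = cong (_*ˢ a zero) (sym (Signₚ.*-identityʳ (s zero)))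
∏-propagate (suc m) s a step = begin
  s (fromℕ (suc m)) *ˢ a (fromℕ (suc m)) ≡⟨ ∏-propagate m (s ∘ suc) (a ∘ suc) (step ∘ suc) ⟩
  ∏s′ *ˢ a (suc zero)                    ≡⟨ cong (∏s′ *ˢ_) (step zero) ⟩
  ∏s′ *ˢ (s zero *ˢ a zero)              ≡⟨ sym (Signₚ.*-assoc ∏s′ (s zero) (a zero)) ⟩
  (∏s′ *ˢ s zero) *ˢ a zero              ≡⟨ cong (_*ˢ a zero) (Signₚ.*-comm ∏s′ (s zero)) ⟩
  ∏ (suc (suc m)) s *ˢ a zero            ∎
  where
  open ≡-Reasoning
  ∏s′ = ∏ (suc m) (s ∘ suc)

∑-telescope : ∀ m (p : Fin (suc (suc m)) → ℤ) (a b : Fin (suc m) → ℤ) →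
  (∀ (i : Fin m) → b (inject₁ i) ≡ - a (suc i)) →
  sum (λ i → p (inject₁ i) * a i + p (suc i) * b i)
    ≡ p zero * a zero + p (fromℕ (suc m)) * b (fromℕ m)
∑-telescope zero    p a b _    = +-identityʳ _
∑-telescope (suc m) p a b link = begin
  first + sum (λ i → p (suc (inject₁ i)) * a (suc i) + p (suc (suc i)) * b (suc i))
    ≡⟨ cong (λ rest → first + rest) (∑-telescope m (p ∘ suc) (a ∘ suc) (b ∘ suc) (link ∘ suc)) ⟩
  first + (p (suc zero) * a (suc zero) + last)
    ≡⟨ cong (λ x → (p zero * a zero + p (suc zero) * x) + (p (suc zero) * a (suc zero) + last))
            (link zero) ⟩
  (p zero * a zero + p (suc zero) * - a (suc zero)) + (p (suc zero) * a (suc zero) + last)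
    ≡⟨ cancel (p zero * a zero) (p (suc zero)) (a (suc zero)) last ⟩
  p zero * a zero + last ∎
  where
  open ≡-Reasoning
  first = p zero * a zero + p (suc zero) * b zero
  last  = p (fromℕ (suc (suc m))) * b (fromℕ (suc m))
  cancel : ∀ x y z w → (x + y * - z) + (y * z + w) ≡ x + w
  cancel = solve-∀

module _ {Σ : SignedGraph} {n : ℕ} {W : Walk Σ n} (D : Direction W) where

  ωW-start ωW-finish : Fin n → Sign
  ωW-start  i = ωW D i (start W i)
  ωW-finish i = ωW D i (not (start W i))

module _ {Σ : SignedGraph} (O : Orientation Σ) {n : ℕ} {W : Walk Σ n} (D : Direction W) where

  ω-*-coupling : ∀ i b → ⟦ ω O (edge W i) b ⟧ * ⟦ coupling O D i ⟧ ≡ ⟦ ωW D i b ⟧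
  ω-*-coupling i b = trans (sym (⟦⟧-* (ω O (edge W i) b) (coupling O D i)))
    (cong ⟦_⟧ (coupling-transport (ω O (edge W i)) (ωW D i) same-product b))
    where
    same-product : ω O (edge W i) true *ˢ ω O (edge W i) false ≡ ωW D i true *ˢ ωW D i false
    same-product = Signₚ.opposite-injective
      (trans (sym (Orientation.isOr O (edge W i))) (Direction.isOr D i))

  η-*-coupling : ∀ v i → η O v (edge W i) * ⟦ coupling O D i ⟧
    ≡ δ (vtx W (inject₁ i) ≟ v) * ⟦ ωW-start D i ⟧ + δ (vtx W (suc i) ≟ v) * ⟦ ωW-finish D i ⟧
  η-*-coupling v i = begin
    η O v e * ⟦ coupling O D i ⟧
      ≡⟨ distrib (δ (end Σ e true ≟ v)) (δ (end Σ e false ≟ v))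
                 ⟦ ω O e true ⟧ ⟦ ω O e false ⟧ ⟦ coupling O D i ⟧ ⟩
    δ (end Σ e true ≟ v) * (⟦ ω O e true ⟧ * ⟦ coupling O D i ⟧)
      + δ (end Σ e false ≟ v) * (⟦ ω O e false ⟧ * ⟦ coupling O D i ⟧)
      ≡⟨ cong₂ _+_ (cong (δ (end Σ e true ≟ v) *_) (ω-*-coupling i true))
                   (cong (δ (end Σ e false ≟ v) *_) (ω-*-coupling i false)) ⟩
    atEnd true + atEnd false
      ≡⟨ both-ends (start W i) ⟩
    atEnd (start W i) + atEnd (not (start W i))
      ≡⟨ cong₂ (λ x y → δ (x ≟ v) * ⟦ ωW-start D i ⟧ + δ (y ≟ v) * ⟦ ωW-finish D i ⟧)
               (startOK W i) (finishOK W i) ⟩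
    δ (vtx W (inject₁ i) ≟ v) * ⟦ ωW-start D i ⟧ + δ (vtx W (suc i) ≟ v) * ⟦ ωW-finish D i ⟧ ∎
    where
    open ≡-Reasoning
    e = edge W i
    atEnd : Bool → ℤ
    atEnd b = δ (end Σ e b ≟ v) * ⟦ ωW D i b ⟧
    both-ends : ∀ b → atEnd true + atEnd false ≡ atEnd b + atEnd (not b)
    both-ends true  = refl
    both-ends false = +-comm (atEnd true) (atEnd false)
    distrib : ∀ a b x y z → (a * x + b * y) * z ≡ a * (x * z) + b * (y * z)
    distrib = solve-∀

module _ {Σ : SignedGraph} {m : ℕ} {W : Walk Σ (suc m)} (D : Direction W) where

  ωW-start-suc : ∀ (i : Fin m) → ωW-start D (suc i) ≡ negˢ (ωW-finish D (inject₁ i))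
  ωW-start-suc i = *ˢ≡-⇒≡negˢ (ωW-finish D (inject₁ i)) (ωW-start D (suc i))
    (internal D (inject₁ i) (suc i) (cong suc (sym (toℕ-inject₁ i))))

  ωW-finish-step : ∀ i → ωW-finish D i ≡ negˢ (σ Σ (edge W i) *ˢ ωW-start D i)
  ωW-finish-step i = end-opposite (ωW D i) (Direction.isOr D i) (start W i)

  ωW-finish-last : ωW-finish D (fromℕ m) ≡ negˢ (walkSign W *ˢ ωW-start D zero)
  ωW-finish-last = trans (ωW-finish-step (fromℕ m))
    (cong negˢ (∏-propagate m (λ i → σ Σ (edge W i)) (ωW-start D) propagate))
    where
    propagate : ∀ i → ωW-start D (suc i) ≡ σ Σ (edge W (inject₁ i)) *ˢ ωW-start D (inject₁ i)
    propagate i = trans (ωW-start-suc i)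
      (trans (cong negˢ (ωW-finish-step (inject₁ i))) (Signₚ.opposite-involutive _))

  ∂-fW : (O : Orientation Σ) (v : Vertex Σ) → ∂ O (fW O D) v
    ≡ δ (vtx W zero ≟ v) * ⟦ ωW-start D zero ⟧
      + δ (vtx W (fromℕ (suc m)) ≟ v) * ⟦ ωW-finish D (fromℕ m) ⟧
  ∂-fW O v = begin
    ∂ O (fW O D) v
      ≡⟨ ∂-as-sum O (fW O D) v ⟩
    sum (λ e → η O v e * fW O D e)
      ≡⟨ sum-cong-≗ (λ e → cong (η O v e *_) (fW-as-sum O D e)) ⟩
    sum (λ e → η O v e * sum (λ i → δ (edge W i ≟ e) * ⟦ coupling O D i ⟧))
      ≡⟨ ∑-*-pushforward (η O v) (edge W) (λ i → ⟦ coupling O D i ⟧) ⟩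
    sum (λ i → η O v (edge W i) * ⟦ coupling O D i ⟧)
      ≡⟨ sum-cong-≗ (η-*-coupling O D v) ⟩
    sum (λ i → δ (vtx W (inject₁ i) ≟ v) * ⟦ ωW-start D i ⟧
               + δ (vtx W (suc i) ≟ v) * ⟦ ωW-finish D i ⟧)
      ≡⟨ ∑-telescope m (λ k → δ (vtx W k ≟ v)) (⟦_⟧ ∘ ωW-start D) (⟦_⟧ ∘ ωW-finish D) link ⟩
    δ (vtx W zero ≟ v) * ⟦ ωW-start D zero ⟧
      + δ (vtx W (fromℕ (suc m)) ≟ v) * ⟦ ωW-finish D (fromℕ m) ⟧ ∎
    where
    open ≡-Reasoning
    link : ∀ i → ⟦ ωW-finish D (inject₁ i) ⟧ ≡ - ⟦ ωW-start D (suc i) ⟧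
    link i = begin
      ⟦ ωW-finish D (inject₁ i) ⟧           ≡⟨ cong ⟦_⟧ (sym (Signₚ.opposite-involutive _)) ⟩
      ⟦ negˢ (negˢ (ωW-finish D (inject₁ i))) ⟧ ≡⟨ ⟦⟧-negˢ _ ⟩
      - ⟦ negˢ (ωW-finish D (inject₁ i)) ⟧   ≡⟨ cong (-_ ∘ ⟦_⟧) (sym (ωW-start-suc i)) ⟩
      - ⟦ ωW-start D (suc i) ⟧              ∎

  ⟦ωW-finish-last⟧ : ⟦ ωW-finish D (fromℕ m) ⟧ ≡ - (⟦ walkSign W ⟧ * ⟦ ωW-start D zero ⟧)
  ⟦ωW-finish-last⟧ = trans (cong ⟦_⟧ ωW-finish-last)
    (trans (⟦⟧-negˢ _) (cong -_ (⟦⟧-* (walkSign W) (ωW-start D zero))))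

lemma3p1 : (Σ : SignedGraph) (O : Orientation Σ) (m : ℕ)
  (W : Walk Σ (suc m)) (D : Direction W) →
  (∀ (v : Vertex Σ) → ¬ (v ≡ vtx W zero) → ¬ (v ≡ vtx W (fromℕ (suc m))) →
    ∂ O (fW O D) v ≡ 0ℤ)
  × (vtx W zero ≡ vtx W (fromℕ (suc m)) →
      (walkSign W ≡ Sign.+ → ∂ O (fW O D) (vtx W zero) ≡ 0ℤ)
      × (walkSign W ≡ Sign.- →
          ∂ O (fW O D) (vtx W zero) ≡ + 2 * ⟦ ωW D zero (start W zero) ⟧))
  × (¬ (vtx W zero ≡ vtx W (fromℕ (suc m))) →
      (∂ O (fW O D) (vtx W zero) ≡ ⟦ ωW D zero (start W zero) ⟧)
      × (∂ O (fW O D) (vtx W (fromℕ (suc m)))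
           ≡ ⟦ ωW D (fromℕ m) (not (start W (fromℕ m))) ⟧)
      × (⟦ ωW D (fromℕ m) (not (start W (fromℕ m))) ⟧
           ≡ - (⟦ walkSign W ⟧ * ⟦ ωW D zero (start W zero) ⟧)))
lemma3p1 Σ O m W D = interior , closed , open-walk
  where
  v₀ = vtx W zero
  vₙ = vtx W (fromℕ (suc m))
  a = ωW-start D zero
  b = ωW-finish D (fromℕ m)
  ∂f : Vertex Σ → ℤ
  ∂f = ∂ O (fW O D)

  ∂f-at : ∀ v {x y} → δ (v₀ ≟ v) ≡ x → δ (vₙ ≟ v) ≡ y → ∂f v ≡ x * ⟦ a ⟧ + y * ⟦ b ⟧
  ∂f-at v p q = trans (∂-fW D O v) (cong₂ (λ x y → x * ⟦ a ⟧ + y * ⟦ b ⟧) p q)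

  interior : ∀ v → ¬ v ≡ v₀ → ¬ v ≡ vₙ → ∂f v ≡ 0ℤ
  interior v v≢v₀ v≢vₙ = ∂f-at v (δ-no (v₀ ≟ v) (v≢v₀ ∘ sym)) (δ-no (vₙ ≟ v) (v≢vₙ ∘ sym))

  closed : v₀ ≡ vₙ → (walkSign W ≡ Sign.+ → ∂f v₀ ≡ 0ℤ) × (walkSign W ≡ Sign.- → ∂f v₀ ≡ + 2 * ⟦ a ⟧)
  closed v₀≡vₙ = (λ σ≡+ → trans (∂f-v₀ σ≡+) (cancel ⟦ a ⟧)) , (λ σ≡- → trans (∂f-v₀ σ≡-) (double ⟦ a ⟧))
    where
    ∂f-v₀ : ∀ {s} → walkSign W ≡ s → ∂f v₀ ≡ ⟦ a ⟧ + - (⟦ s ⟧ * ⟦ a ⟧)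
    ∂f-v₀ σ≡s = trans (∂f-at v₀ (δ-yes (v₀ ≟ v₀) refl) (δ-yes (vₙ ≟ v₀) (sym v₀≡vₙ)))
      (cong₂ _+_ (*-identityˡ ⟦ a ⟧) (trans (*-identityˡ ⟦ b ⟧)
        (trans (⟦ωW-finish-last⟧ D) (cong (λ s → - (⟦ s ⟧ * ⟦ a ⟧)) σ≡s))))
    cancel : ∀ x → x + - (1ℤ * x) ≡ 0ℤ
    cancel = solve-∀
    double : ∀ x → x + - (-1ℤ * x) ≡ + 2 * x
    double = solve-∀

  open-walk : ¬ v₀ ≡ vₙ → (∂f v₀ ≡ ⟦ a ⟧) × (∂f vₙ ≡ ⟦ b ⟧) × (⟦ b ⟧ ≡ - (⟦ walkSign W ⟧ * ⟦ a ⟧))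
  open-walk v₀≢vₙ =
      trans (∂f-at v₀ (δ-yes (v₀ ≟ v₀) refl) (δ-no (vₙ ≟ v₀) (v₀≢vₙ ∘ sym)))
            (trans (+-identityʳ _) (*-identityˡ ⟦ a ⟧))
    , trans (∂f-at vₙ (δ-no (v₀ ≟ vₙ) v₀≢vₙ) (δ-yes (vₙ ≟ vₙ) refl))
            (trans (+-identityˡ _) (*-identityˡ ⟦ b ⟧))
    , ⟦ωW-finish-last⟧ D
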